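{- Let $\Gamma,\Delta,\Gamma_1,\Delta_1,\dots,\Gamma_n,\Delta_n$ ($n\ge1$) be finite multisets of unlabeled DLp formulas, and suppose the rule with premises $\Gamma_1\Rightarrow\Delta_1,\dots,\Gamma_n\Rightarrow\Delta_n$ and conclusion $\Gamma\Rightarrow\Delta$ is sound. Then for every label $\sigma\in\mathrm{Conf}$ that is free with respect to $A=\Gamma\cup\Delta\cup\Gamma_1\cup\Delta_1\cup\dots\cup\Gamma_n\cup\Delta_n$, the rule with premises $\sigma:\Gamma_1\Rightarrow\sigma:\Delta_1,\dots,\sigma:\Gamma_n\Rightarrow\sigma:\Delta_n$ and conclusion $\sigma:\Gamma\Rightarrow\sigma:\Delta$ is sound.
   Context: Fix disjoint sets $\mathrm{Prog}$ (programs, containing a terminal program $\mathbf{ter}$) and $\mathrm{Fmla}$. DLp formulas: $\phi::=F\mid\neg\phi\mid\phi\wedge\phi\mid[\alpha]\phi$ ($F\in\mathrm{Fmla}$, $\alpha\in\mathrm{Prog}$). Fix a structure $K=(W,\to,I)$ with $W$ a set of worlds, $\to\subseteq W\times(\mathrm{Prog}\times\mathrm{Prog})\times W$ (written $w\xrightarrow{\alpha/\alpha'}w'$), $I:\mathrm{Fmla}\to\mathcal P(W)$, no relation $w\xrightarrow{\mathbf{ter}/\alpha}w'$. An execution path is $w_1\xrightarrow{\alpha_1/\beta_1}\cdots\xrightarrow{\alpha_n/\beta_n}w_{n+1}$ ($n\ge0$) of relations of $K$ with $\beta_n=\mathbf{ter}$, $\beta_i=\alpha_{i+1}\ne\mathbf{ter}$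 for $i<n$. Semantics: $w\models F$ iff $w\in I(F)$; $\neg,\wedge$ as usual; $w\models[\alpha]\phi$ iff $w'\models\phi$ for all execution paths $w\xrightarrow{\alpha/\cdot}\cdots\xrightarrow{\cdot/\mathbf{ter}}w'$. A sequent of unlabeled formulas $\Gamma\Rightarrow\Delta$ is valid if every world satisfying all of $\Gamma$ satisfies some formula of $\Delta$. Fix a set $\mathrm{Conf}$ of labels and a set $\mathrm{LM}$ of label mappings $m:\mathrm{Conf}\to W$. A labeled formula $\sigma:\phi$ is satisfied by $m$ iff $m(\sigma)\models\phi$; for a multiset $A$ of formulas, $\sigma:A=\{\sigma:\phi\mid\phi\in A\}$; a labeled sequent is valid if every $m\in\mathrm{LM}$ satisfying all formulas on the left satisfies some formula on the right. A rule is sound if validity of all premises implies validity of the conclusion. Two worlds $w,w'$ have the same effect w.r.t. a set $A$ of unlabeled formulas if for all $\phi\in A$, $w\models\phi$ iff $w'\models\phi$. A label $\sigma$ is free w.r.t. $A$ if for every world $w\in W$ there is $m\in\mathrm{LM}$ such that $w$ and $m(\sigma)$ have the same effect w.r.t. $A$. -}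

module Defs where

open import Data.Nat using (ℕ; _≥_)
open import Data.Fin using (Fin)
open import Data.List using (List; _++_; concatMap; tabulate)
open import Data.List.Membership.Propositional using (_∈_)
open import Data.List.Relation.Unary.All using (All)
open import Data.List.Relation.Unary.Any using (Any)
open import Data.Product using (_×_; Σ)
open import Relation.Nullary using (¬_)
open import Relation.Binary.PropositionalEquality using (_≡_; _≢_)
open import Function.Bundles using (_⇔_)

data DLp (Prog Fmla : Set) : Set where
  atom : Fmla → DLp Prog Fmla
  ¬'_  : DLp Prog Fmla → DLp Prog Fmla
  _∧'_ : DLp Prog Fmla → DLp Prog Fmla → DLp Prog Fmla
  [_]_ : Prog → DLp Prog Fmla → DLp Prog Fmla

record Structure (Prog Fmla : Set) (ter : Prog) : Set₁ where
  field
    W     : Set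
    _⟶⟨_/_⟩_ : W → Prog → Prog → W → Set
    I     : Fmla → W → Set
    noTer : ∀ {w α w'} → ¬ (w ⟶⟨ ter / α ⟩ w')

module Semantics {Prog Fmla : Set} {ter : Prog} (K : Structure Prog Fmla ter) where
  open Structure K

  data Path : W → Prog → W → Set where
    last : ∀ {w α w'} → w ⟶⟨ α / ter ⟩ w' → Path w α w'
    cons : ∀ {w α β w' w''} → w ⟶⟨ α / β ⟩ w' → β ≢ ter → Path w' β w'' → Path w α w''

  Form : Set
  Form = DLp Prog Fmla

  _⊨_ : W → Form → Set
  w ⊨ atom F   = I F w
  w ⊨ (¬' φ)   = ¬ (w ⊨ φ)
  w ⊨ (φ ∧' ψ) = (w ⊨ φ) × (w ⊨ ψ)
  w ⊨ ([ α ] φ) = ∀ w' → Path w α w' → w' ⊨ φ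

  -- unlabeled sequents (finite multisets as lists)
  record Sequent : Set where
    constructor _⇒_
    field
      ante : List Form
      succ : List Form

  ValidSeq : Sequent → Set
  ValidSeq (Γ ⇒ Δ) = ∀ (w : W) → All (w ⊨_) Γ → Any (w ⊨_) Δ

  SoundRule : {n : ℕ} → (Fin n → Sequent) → Sequent → Set
  SoundRule prem concl = (∀ i → ValidSeq (prem i)) → ValidSeq concl

  -- labeled sequents σ:Γ ⇒ σ:Δ with label mappings from LM
  module Labeled (Conf : Set) (LM : (Conf → W) → Set) where
    ValidLabSeq : Conf → Sequent → Set
    ValidLabSeq σ (Γ ⇒ Δ) =
      ∀ (m : Conf → W) → LM m → All (λ φ → m σ ⊨ φ) Γ → Any (λ φ → m σ ⊨ φ) Δ

    SoundLabRule : {n : ℕ} → Conf → (Fin n → Sequent) → Sequent → Set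
    SoundLabRule σ prem concl = (∀ i → ValidLabSeq σ (prem i)) → ValidLabSeq σ concl

    SameEffect : List Form → W → W → Set
    SameEffect A w w' = ∀ φ → φ ∈ A → (w ⊨ φ) ⇔ (w' ⊨ φ)

    Free : Conf → List Form → Set
    Free σ A = ∀ (w : W) → Σ (Conf → W) (λ m → LM m × SameEffect A w (m σ))

  seqFormulas : Sequent → List Form
  seqFormulas (Γ ⇒ Δ) = Γ ++ Δ

  ruleFormulas : {n : ℕ} → (Fin n → Sequent) → Sequent → List Form
  ruleFormulas prem concl = seqFormulas concl ++ concatMap seqFormulas (tabulate prem)

{-# OPTIONS --safe #-}
module Submission where

-- Labeled validity at σ only looks at the worlds m σ. If σ is free, every world agrees with
-- some m σ on all formulas of the rule, so a premise valid at σ is valid outright. Soundness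
-- of the unlabeled rule then makes the conclusion valid at every world, in particular at m σ.

open import Defs
open import Data.Nat using (ℕ; _≥_)
open import Data.Fin using (Fin)
open import Data.List.Membership.Propositional using (find; lose)
open import Data.List.Membership.Propositional.Properties using (∈-concatMap⁺)
open import Data.List.Relation.Binary.Subset.Propositional using (_⊆_)
open import Data.List.Relation.Binary.Subset.Propositional.Properties using (xs⊆xs++ys; xs⊆ys++xs)
open import Data.List.Relation.Unary.All as All using (All)
open import Data.List.Relation.Unary.Any using (Any)
open import Data.List.Relation.Unary.Any.Properties using (tabulate⁺)
open import Data.Product using (_,_)
open import Function using (_∘_)
open import Function.Bundles using (Equivalence)
import Function.Properties.Equivalence as ⇔

module _ {Prog Fmla : Set} {ter : Prog} (K : Structure Prog Fmla ter) where
  open Structure K using (W)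
  open Semantics K

  premise⊆ruleFormulas : ∀ {n} (prem : Fin n → Sequent) (concl : Sequent) (i : Fin n)
    → seqFormulas (prem i) ⊆ ruleFormulas prem concl
  premise⊆ruleFormulas prem concl i =
    xs⊆ys++xs _ (seqFormulas concl) ∘ ∈-concatMap⁺ seqFormulas ∘ tabulate⁺ i

  module _ (Conf : Set) (LM : (Conf → W) → Set) where
    open Labeled Conf LM

    SameEffect-sym : ∀ {A w w'} → SameEffect A w w' → SameEffect A w' w
    SameEffect-sym same φ φ∈A = ⇔.sym (same φ φ∈A)

    SameEffect-anti : ∀ {A B w w'} → A ⊆ B → SameEffect B w w' → SameEffect A w w'
    SameEffect-anti A⊆B same φ = same φ ∘ A⊆B

    Free-anti : ∀ {σ A B} → A ⊆ B → Free σ B → Free σ A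
    Free-anti A⊆B free w with free w
    ... | m , lm , same = m , lm , SameEffect-anti A⊆B same

    All-transport : ∀ {A w w'} → SameEffect A w w' → All (w ⊨_) A → All (w' ⊨_) A
    All-transport same w⊨A =
      All.tabulate λ φ∈A → Equivalence.to (same _ φ∈A) (All.lookup w⊨A φ∈A)

    Any-transport : ∀ {A w w'} → SameEffect A w w' → Any (w ⊨_) A → Any (w' ⊨_) A
    Any-transport same w⊨A with find w⊨A
    ... | φ , φ∈A , w⊨φ = lose φ∈A (Equivalence.to (same φ φ∈A) w⊨φ)

    validSeq⇒validLabSeq : ∀ σ s → ValidSeq s → ValidLabSeq σ s
    validSeq⇒validLabSeq σ (Γ ⇒ Δ) valid m _ = valid (m σ)

    validLabSeq⇒validSeq : ∀ σ s → Free σ (seqFormulas s) → ValidLabSeq σ s → ValidSeq s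
    validLabSeq⇒validSeq σ (Γ ⇒ Δ) free valid w w⊨Γ with free w
    ... | m , lm , same =
      Any-transport (SameEffect-sym (SameEffect-anti (xs⊆ys++xs Δ Γ) same))
        (valid m lm (All-transport (SameEffect-anti (xs⊆xs++ys Γ Δ) same) w⊨Γ))

proposition5p10 : {Prog Fmla : Set} {ter : Prog} (K : Structure Prog Fmla ter)
    → (Conf : Set) (LM : (Conf → Structure.W K) → Set)
    → (n : ℕ) → n ≥ 1
    → (prem : Fin n → Semantics.Sequent K) (concl : Semantics.Sequent K)
    → Semantics.SoundRule K prem concl
    → (σ : Conf)
    → Semantics.Labeled.Free K Conf LM σ (Semantics.ruleFormulas K prem concl)
    → Semantics.Labeled.SoundLabRule K Conf LM σ prem concl
proposition5p10 K Conf LM _ _ prem concl sound σ free validPrem =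
  validSeq⇒validLabSeq K Conf LM σ concl (sound validUnlabeledPrem)
  where
  validUnlabeledPrem : ∀ i → Semantics.ValidSeq K (prem i)
  validUnlabeledPrem i =
    validLabSeq⇒validSeq K Conf LM σ (prem i)
      (Free-anti K Conf LM (premise⊆ruleFormulas K prem concl i) free) (validPrem i)
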